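{- The consecutive patterns of relations $(\underline{<,\geq})$ and $(\underline{\neq,\geq})$ are Wilf equivalent (i.e. $|\mathbf{I}_n(\underline{<,\geq})|=|\mathbf{I}_n(\underline{\neq,\geq})|$ for all $n$), but not strongly Wilf equivalent.
   Context: An inversion sequence of length $n$ is an integer sequence $e=e_1\dots e_n$ with $0\le e_i<i$ for all $i$; $\mathbf{I}_n$ is the set of these. For relations $R_1,R_2$, an occurrence of the consecutive pattern of relations $(\underline{R_1,R_2})$ in position $i$ of $e$ means $e_iR_1e_{i+1}$ and $e_{i+1}R_2e_{i+2}$; $\mathbf{I}_n(\underline{R_1,R_2})$ is the set of $e\in\mathbf{I}_n$ with no occurrence. Two patterns are strongly Wilf equivalent if for all $n,m$ the number of $e\in\mathbf{I}_n$ with exactly $m$ occurrences is the same for both. -}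

module Defs where

open import Data.Nat using (ℕ; zero; suc; _<ᵇ_; _≡ᵇ_)
open import Data.Bool using (Bool; true; false; not; if_then_else_)
open import Data.List using (List; []; _∷_; _++_; map; concatMap; length; upTo; filter; reverse)
open import Relation.Nullary.Decidable using (does)
open import Relation.Binary.PropositionalEquality using (_≡_)
open import Data.Product using (_×_; _,_)
import Data.Nat as ℕ

Rel₂ : Set
Rel₂ = ℕ → ℕ → Bool

lt : Rel₂
lt a b = a <ᵇ b

neq : Rel₂
neq a b = not (a ≡ᵇ b)

geq : Rel₂
geq a b = not (a <ᵇ b)

-- Inversion sequences of length n, e = e₁ … eₙ with 0 ≤ eᵢ < i,
-- represented as lists [e₁, …, eₙ]. Built by appending the last entry.
-- invSeqs n enumerates 𝐈ₙ (each sequence exactly once).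
invSeqs : ℕ → List (List ℕ)
invSeqs zero = [] ∷ []
invSeqs (suc n) = concatMap (λ e → map (λ x → e ++ (x ∷ [])) (upTo (suc n))) (invSeqs n)

occurrences : Rel₂ → Rel₂ → List ℕ → ℕ
occurrences R₁ R₂ (a ∷ rest@(b ∷ c ∷ _)) =
  (if R₁ a b ∧' R₂ b c then 1 else 0) ℕ.+ occurrences R₁ R₂ rest
  where
    _∧'_ : Bool → Bool → Bool
    true ∧' y = y
    false ∧' _ = false
occurrences R₁ R₂ _ = 0

numWithOcc : Rel₂ → Rel₂ → ℕ → ℕ → ℕ
numWithOcc R₁ R₂ n m = length (filter (λ e → occurrences R₁ R₂ e ℕ.≟ m) (invSeqs n))

numAvoid : Rel₂ → Rel₂ → ℕ → ℕ
numAvoid R₁ R₂ n = length (filter (λ e → occurrences R₁ R₂ e ℕ.≟ 0) (invSeqs n))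

WilfEquiv : (Rel₂ × Rel₂) → (Rel₂ × Rel₂) → Set
WilfEquiv (R₁ , R₂) (S₁ , S₂) = ∀ n → numAvoid R₁ R₂ n ≡ numAvoid S₁ S₂ n

StronglyWilfEquiv : (Rel₂ × Rel₂) → (Rel₂ × Rel₂) → Set
StronglyWilfEquiv (R₁ , R₂) (S₁ , S₂) = ∀ n m → numWithOcc R₁ R₂ n m ≡ numWithOcc S₁ S₂ n m

module Submission where

-- Every inversion sequence of positive length starts with 0.
-- For such a sequence, avoiding (<,≥) and avoiding (≠,≥) are equivalent:
--   * (≠,≥) ⇒ (<,≥): every occurrence of (<,≥) is one of (≠,≥), because
--     occurrence counts are monotone in the two relations;
--   * (<,≥) ⇒ (≠,≥): a (<,≥)-avoider starting with 0 is a block of zeros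
--     (no occurrence of (≠,≥) there, ≠ being irreflexive) followed by an
--     ascent, after which avoidance forces the rest to be strictly
--     increasing, so there is no weak descent left to complete (≠,≥).
-- Filtering 𝐈ₙ by two predicates that agree on each of its members gives
-- the same list, hence Wilf equivalence.  Strong Wilf equivalence fails
-- already for n = 4, m = 2 (e.g. 0100 has two occurrences of (≠,≥), while
-- no sequence in 𝐈₄ has two occurrences of (<,≥)); this is a computation.

open import Defs
open import Data.Product using (_×_; _,_; ∃)
open import Relation.Nullary using (¬_; contradiction)
open import Data.Nat using (ℕ; zero; suc; _≤_; z≤n; s≤s; _<ᵇ_)
open import Data.Nat.Properties using (+-mono-≤; n≤0⇒n≡0)
open import Data.Bool using (true; false; not)
open import Data.List using (List; []; _∷_; _++_; map; upTo; filter; length)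
open import Data.List.Relation.Unary.All as All using (All; []; _∷_)
open import Data.List.Relation.Unary.All.Properties using (concat⁺; map⁺)
open import Data.List.Relation.Unary.Linked using (Linked; [-]; _∷_)
open import Relation.Binary.PropositionalEquality using (_≡_; refl; cong; subst; trans)
open import Relation.Unary using (Pred; Decidable)
open import Relation.Nullary.Decidable using (yes; no)
open import Function.Bundles using (_⇔_; Equivalence)
open import Level using (0ℓ)

Avoids : Rel₂ → Rel₂ → List ℕ → Set
Avoids R₁ R₂ e = occurrences R₁ R₂ e ≡ 0

_⊆_ : Rel₂ → Rel₂ → Set
R ⊆ S = ∀ a b → R a b ≡ true → S a b ≡ true

occurrences-mono : ∀ {R₁ R₂ S₁ S₂} → R₁ ⊆ S₁ → R₂ ⊆ S₂ →
                   ∀ e → occurrences R₁ R₂ e ≤ occurrences S₁ S₂ e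
occurrences-mono sub₁ sub₂ []          = z≤n
occurrences-mono sub₁ sub₂ (a ∷ [])     = z≤n
occurrences-mono sub₁ sub₂ (a ∷ b ∷ []) = z≤n
occurrences-mono {R₁} {R₂} {S₁} {S₂} sub₁ sub₂ (a ∷ b ∷ c ∷ t)
  with ih ← occurrences-mono sub₁ sub₂ (b ∷ c ∷ t) | R₁ a b in r₁
... | false = +-mono-≤ z≤n ih
... | true rewrite sub₁ a b r₁ with R₂ b c in r₂
...   | false = +-mono-≤ z≤n ih
...   | true rewrite sub₂ b c r₂ = s≤s ih

avoids-anti : ∀ {R₁ R₂ S₁ S₂} → R₁ ⊆ S₁ → R₂ ⊆ S₂ →
              ∀ e → Avoids S₁ S₂ e → Avoids R₁ R₂ e
avoids-anti sub₁ sub₂ e none =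
  n≤0⇒n≡0 (subst (occurrences _ _ e ≤_) none (occurrences-mono sub₁ sub₂ e))

lt⊆neq : lt ⊆ neq
lt⊆neq zero    (suc b) _  = refl
lt⊆neq (suc a) (suc b) ab = lt⊆neq a b ab

Ascending : List ℕ → Set
Ascending = Linked (λ a b → lt a b ≡ true)

ascent-avoider-ascending : ∀ a b t → lt a b ≡ true →
                           Avoids lt geq (a ∷ b ∷ t) → Ascending (a ∷ b ∷ t)
ascent-avoider-ascending a b []      ab _ = ab ∷ [-]
ascent-avoider-ascending a b (c ∷ t) ab none rewrite ab with b <ᵇ c in bc
... | true  = ab ∷ ascent-avoider-ascending b c t bc none
... | false with () ← none

skip-first-fails : ∀ R₁ R₂ {a b} c t → R₁ a b ≡ false →
                   occurrences R₁ R₂ (a ∷ b ∷ c ∷ t) ≡ occurrences R₁ R₂ (b ∷ c ∷ t)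
skip-first-fails R₁ R₂ {a} {b} c t fails with R₁ a b | fails
... | false | refl = refl

skip-second-fails : ∀ R₁ R₂ a {b c} t → R₂ b c ≡ false →
                    occurrences R₁ R₂ (a ∷ b ∷ c ∷ t) ≡ occurrences R₁ R₂ (b ∷ c ∷ t)
skip-second-fails R₁ R₂ a {b} {c} t fails with R₁ a b | R₂ b c | fails
... | true  | false | refl = refl
... | false | false | refl = refl

ascending-avoids : ∀ R e → Ascending e → Avoids R geq e
ascending-avoids R []              _          = refl
ascending-avoids R (a ∷ [])         _          = refl
ascending-avoids R (a ∷ b ∷ [])     _          = refl
ascending-avoids R (a ∷ b ∷ c ∷ t) (_ ∷ asc@(bc ∷ _)) =
  trans (skip-second-fails R geq a t (cong not bc)) (ascending-avoids R (b ∷ c ∷ t) asc)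

-- For a list starting with 0, avoiding (<,≥) implies avoiding (R,≥) for
-- any irreflexive R: the leading zeros contribute nothing, and the first
-- nonzero entry is an ascent.
zero-head-avoids : ∀ R → (∀ a → R a a ≡ false) →
                   ∀ t → Avoids lt geq (0 ∷ t) → Avoids R geq (0 ∷ t)
zero-head-avoids R irr []                _    = refl
zero-head-avoids R irr (b ∷ [])           _    = refl
zero-head-avoids R irr (zero ∷ c ∷ t)     none =
  trans (skip-first-fails R geq c t (irr 0)) (zero-head-avoids R irr (c ∷ t) none)
zero-head-avoids R irr (suc b ∷ c ∷ t)    none =
  ascending-avoids R (0 ∷ suc b ∷ c ∷ t)
    (ascent-avoider-ascending 0 (suc b) (c ∷ t) refl none)

neq-irreflexive : ∀ a → neq a a ≡ false
neq-irreflexive zero    = refl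
neq-irreflexive (suc a) = neq-irreflexive a

zero-head-avoids⇔ : ∀ t → Avoids lt geq (0 ∷ t) ⇔ Avoids neq geq (0 ∷ t)
zero-head-avoids⇔ t = record
  { to        = zero-head-avoids neq neq-irreflexive t
  ; from      = avoids-anti lt⊆neq (λ _ _ ge → ge) (0 ∷ t)
  ; to-cong   = λ { refl → refl }
  ; from-cong = λ { refl → refl }
  }

filter-cong : ∀ {A : Set} {P Q : Pred A 0ℓ} (P? : Decidable P) (Q? : Decidable Q) →
              ∀ {xs} → All (λ x → P x ⇔ Q x) xs → filter P? xs ≡ filter Q? xs
filter-cong P? Q? [] = refl
filter-cong P? Q? {x ∷ xs} (P⇔Q ∷ rest) with P? x | Q? x
... | yes _ | yes _ = cong (x ∷_) (filter-cong P? Q? rest)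
... | no  _ | no  _ = filter-cong P? Q? rest
... | yes p | no ¬q = contradiction (Equivalence.to P⇔Q p) ¬q
... | no ¬p | yes q = contradiction (Equivalence.from P⇔Q q) ¬p

StartsWithZero : List ℕ → Set
StartsWithZero e = ∃ λ t → e ≡ 0 ∷ t

invSeqs-start-with-zero : ∀ n → All StartsWithZero (invSeqs (suc n))
invSeqs-start-with-zero zero    = ([] , refl) ∷ []
invSeqs-start-with-zero (suc n) =
  concat⁺ (map⁺ (All.map extensions (invSeqs-start-with-zero n)))
  where
  extensions : ∀ {e} → StartsWithZero e →
               All StartsWithZero (map (λ x → e ++ (x ∷ [])) (upTo (suc (suc n))))
  extensions (t , refl) = map⁺ (All.universal (λ x → t ++ (x ∷ []) , refl) _)

wilf-equivalent : WilfEquiv (lt , geq) (neq , geq)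
wilf-equivalent zero    = refl
wilf-equivalent (suc n) = cong length (filter-cong _ _ agree)
  where
  agree : All (λ e → Avoids lt geq e ⇔ Avoids neq geq e) (invSeqs (suc n))
  agree = All.map (λ { (t , refl) → zero-head-avoids⇔ t })
                  (invSeqs-start-with-zero n)

counts-differ : ¬ numWithOcc lt geq 4 2 ≡ numWithOcc neq geq 4 2
counts-differ ()

proposition3p6 : WilfEquiv (lt , geq) (neq , geq) × ¬ StronglyWilfEquiv (lt , geq) (neq , geq)
proposition3p6 = wilf-equivalent , λ strong → counts-differ (strong 4 2)
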